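{- Let $\varrho\in\mathcal{R}_p(1)$ and $v,d\ge0$. Then: (a) for every level-$d$ minterm $\mu$ (in $v$ variables), $\mu*\varrho$ is $\approx$ to a single level-$d$ minterm, and the map $f_\varrho(\mu)=\mu*\varrho$ is a bijection of the set of level-$d$ minterms; (b) for every prime orbit $\omega$ of level-$d$ minterms, $\omega*\varrho:=\{\mu*\varrho:\mu\in\omega\}$ is a prime orbit, and the map $\omega\mapsto\omega*\varrho$ is a bijection of the set of prime orbits.
   Context: Language: variables $p_1,p_2,\dots$, constants $0,1$, connectives $\neg,\vee,\wedge$, modal operator $\lozenge$. $\mathbf{E}$ is the smallest set of formulas containing all tautologies and closed under modus ponens, uniform substitution and RE (from $\varphi\leftrightarrow\psi$ infer $\lozenge\varphi\leftrightarrow\lozenge\psi$). $\varphi\approx\psi$ means $\vdash_{\mathbf{E}}\varphi\leftrightarrow\psi$. $\mathcal{F}(v,d)$: formulas in $p_1,\dots,p_v$ of $\lozenge$-depth $\le d$. DCF minterms (fixed $v$): level-0 minterms are $\pm p_1\wedge\dots\wedge\pm p_v$; DCF formulas of $\mathcal{F}(v,0)$ are disjunctions of sets of distinct level-0 minterms; for $d\ge1$ the level-$d$ modal factors are $\lozenge\phi$ for every DCF formula $\phi$ of $\mathcal{F}(v,d-1)$, a level-$d$ minterm is a level-0 minterm conjoined with every level-$d$ modal factor, each plain or negated, and DCF formulas of $\mathcal{F}(v,d)$ are disjunctions of sets of distinct level-$d$ minterms. Every formula of $\mathcal{F}(v,d)$ is $\approx$ to a unique DCF formula. Prime orbits: a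 level-0 substitution is a tuple $\sigma=(\sigma_1,\dots,\sigma_v)$ of non-modal formulas in $p_1,\dots,p_v$ (up to $\approx$), acting by $\varphi\mapsto\varphi\circ\sigma$ (replace each $p_i$ by $\sigma_i$); under composition $(\sigma\sigma')_i=\sigma_i(\sigma'_1,\dots,\sigma'_v)$ they form a monoid whose invertible elements form the group $\mathcal{S}_p(v,0)$ of prime substitutions. For prime $\varsigma$, $\mu\circ\varsigma$ is $\approx$ to a single level-$d$ minterm; the orbits of the resulting action on level-$d$ minterms are the prime orbits. Uniform replacements: a UR is a formula $\rho(e)$ of modal degree $\le1$ in one variable $e$; $\varphi*\rho$ is defined recursively by $0*\rho=0$, $1*\rho=1$, $p_i*\rho=p_i$, $(\psi\vee\theta)*\rho=(\psi*\rho)\vee(\theta*\rho)$, $(\neg\psi)*\rho=\neg(\psi*\rho)$, $(\lozenge\psi)*\rho=\rho(\psi*\rho)$ (substitute $\psi*\rho$ for $e$). $\mathcal{R}_p(1)$ is the set of 24 URs: $\lambda\leftrightarrow\tau$ with $\lambda\in\{\lozenge e,\neg\lozenge e\}$, $\tau\in\{1,e,e\vee\lozenge\neg e,e\vee\neg\lozenge\neg e,\neg e\vee\lozenge\neg e,\neg e\vee\neg\lozenge\neg e\}$, and $\lambda\leftrightarrow\tau$ with $\lambda\in\{\lozenge\neg e,\neg\lozenge\neg e\}$, $\tau\in\{1,e,e\vee\lozenge e,e\vee\neg\lozenge e,\neg e\vee\lozenge e,\neg e\vee\neg\lozenge e\}$. -}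

module Defs where

open import Data.Nat using (ℕ; zero; suc; _<?_)
open import Data.Bool using (Bool; true; false; _∧_; _∨_; not; if_then_else_)
open import Data.Fin using (Fin; toℕ; fromℕ<)
open import Data.List using (List; []; _∷_; map; concatMap; _++_; upTo; length; lookup)
open import Data.List.Membership.Propositional using (_∈_)
open import Data.Product using (Σ; ∃; _×_; _,_)
open import Relation.Binary.PropositionalEquality using (_≡_)
open import Relation.Nullary using (yes; no)
open import Function.Bundles using (_⇔_)
open import Function.Definitions using (Bijective)

-- Formulas: variables p_1,p_2,... are  var 0, var 1, ...

infixr 6 _∧ᶠ_
infixr 5 _∨ᶠ_

data Fm : Set where
  var   : ℕ → Fm
  𝟘 𝟙   : Fm
  ¬ᶠ_   : Fm → Fm
  _∨ᶠ_  : Fm → Fm → Fm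
  _∧ᶠ_  : Fm → Fm → Fm
  ◇_    : Fm → Fm

_→ᶠ_ : Fm → Fm → Fm
a →ᶠ b = ¬ᶠ a ∨ᶠ b

_↔ᶠ_ : Fm → Fm → Fm
a ↔ᶠ b = (a →ᶠ b) ∧ᶠ (b →ᶠ a)

eval : (ℕ → Bool) → (Fm → Bool) → Fm → Bool
eval a m (var i)  = a i
eval a m 𝟘        = false
eval a m 𝟙        = true
eval a m (¬ᶠ φ)   = not (eval a m φ)
eval a m (φ ∨ᶠ ψ) = eval a m φ ∨ eval a m ψ
eval a m (φ ∧ᶠ ψ) = eval a m φ ∧ eval a m ψ
eval a m (◇ φ)    = m φ

Tautology : Fm → Set
Tautology φ = ∀ (a : ℕ → Bool) (m : Fm → Bool) → eval a m φ ≡ true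

sub : (ℕ → Fm) → Fm → Fm
sub σ (var i)  = σ i
sub σ 𝟘        = 𝟘
sub σ 𝟙        = 𝟙
sub σ (¬ᶠ φ)   = ¬ᶠ sub σ φ
sub σ (φ ∨ᶠ ψ) = sub σ φ ∨ᶠ sub σ ψ
sub σ (φ ∧ᶠ ψ) = sub σ φ ∧ᶠ sub σ ψ
sub σ (◇ φ)    = ◇ sub σ φ

data ⊢E : Fm → Set where
  taut : ∀ {φ} → Tautology φ → ⊢E φ
  mp   : ∀ {φ ψ} → ⊢E φ → ⊢E (φ →ᶠ ψ) → ⊢E ψ
  us   : ∀ {φ} (σ : ℕ → Fm) → ⊢E φ → ⊢E (sub σ φ)
  re   : ∀ {φ ψ} → ⊢E (φ ↔ᶠ ψ) → ⊢E ((◇ φ) ↔ᶠ (◇ ψ))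

infix 4 _≈_
_≈_ : Fm → Fm → Set
φ ≈ ψ = ⊢E (φ ↔ᶠ ψ)

conj : List Fm → Fm
conj []           = 𝟙
conj (x ∷ [])     = x
conj (x ∷ y ∷ xs) = x ∧ᶠ conj (y ∷ xs)

disj : List Fm → Fm
disj []           = 𝟘
disj (x ∷ [])     = x
disj (x ∷ y ∷ xs) = x ∨ᶠ disj (y ∷ xs)

signings : List Fm → List (List Fm)
signings []       = [] ∷ []
signings (x ∷ xs) = concatMap (λ s → (x ∷ s) ∷ ((¬ᶠ x) ∷ s) ∷ []) (signings xs)

subsets : {A : Set} → List A → List (List A)
subsets []       = [] ∷ []
subsets (x ∷ xs) = map (x ∷_) (subsets xs) ++ subsets xs

level0 : ℕ → List Fm
level0 v = map conj (signings (map var (upTo v)))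

dcf : List Fm → List Fm
dcf ms = map disj (subsets ms)

minterms : ℕ → ℕ → List Fm
minterms v zero    = level0 v
minterms v (suc d) =
  concatMap (λ m0 → map (λ s → m0 ∧ᶠ conj s)
                        (signings (map ◇_ (dcf (minterms v d)))))
            (level0 v)

N : ℕ → ℕ → ℕ
N v d = length (minterms v d)

μ : (v d : ℕ) → Fin (N v d) → Fm
μ v d = lookup (minterms v d)

data NonModal (v : ℕ) : Fm → Set where
  nm-var : ∀ (i : Fin v) → NonModal v (var (toℕ i))
  nm-0   : NonModal v 𝟘
  nm-1   : NonModal v 𝟙
  nm-¬   : ∀ {φ} → NonModal v φ → NonModal v (¬ᶠ φ)
  nm-∨   : ∀ {φ ψ} → NonModal v φ → NonModal v ψ → NonModal v (φ ∨ᶠ ψ)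
  nm-∧   : ∀ {φ ψ} → NonModal v φ → NonModal v ψ → NonModal v (φ ∧ᶠ ψ)

Subst0 : ℕ → Set
Subst0 v = Fin v → Fm

ext : ∀ {v} → Subst0 v → ℕ → Fm
ext {v} σ k with k <? v
... | yes k<v = σ (fromℕ< k<v)
... | no  _   = var k

_∘ˢ_ : ∀ {v} → Fm → Subst0 v → Fm
φ ∘ˢ σ = sub (ext σ) φ

IsLevel0Subst : (v : ℕ) → Subst0 v → Set
IsLevel0Subst v σ = ∀ i → NonModal v (σ i)

_·ˢ_ : ∀ {v} → Subst0 v → Subst0 v → Subst0 v
(σ ·ˢ σ') i = σ i ∘ˢ σ'

idˢ : ∀ {v} → Subst0 v
idˢ i = var (toℕ i)

-- invertible elements of the monoid (equality of substitutions is
-- componentwise ≈)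
IsPrime : (v : ℕ) → Subst0 v → Set
IsPrime v σ = IsLevel0Subst v σ ×
  Σ (Subst0 v) λ τ → IsLevel0Subst v τ ×
    (∀ i → (σ ·ˢ τ) i ≈ idˢ i) × (∀ i → (τ ·ˢ σ) i ≈ idˢ i)

Orb : (v d : ℕ) → Fin (N v d) → Fin (N v d) → Set
Orb v d i j = Σ (Subst0 v) λ ς → IsPrime v ς × (μ v d i ∘ˢ ς ≈ μ v d j)

MSet : ℕ → ℕ → Set₁
MSet v d = Fin (N v d) → Set

SameSet : (v d : ℕ) → MSet v d → MSet v d → Set
SameSet v d S T = ∀ j → S j ⇔ T j

IsPrimeOrbit : (v d : ℕ) → MSet v d → Set
IsPrimeOrbit v d ω = Σ (Fin (N v d)) λ i → ∀ j → ω j ⇔ Orb v d i j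

e : Fm
e = var 0

_⟨_⟩ : Fm → Fm → Fm
ρ ⟨ ψ ⟩ = sub (λ _ → ψ) ρ

_*_ : Fm → Fm → Fm
var i    * ρ = var i
𝟘        * ρ = 𝟘
𝟙        * ρ = 𝟙
(¬ᶠ φ)   * ρ = ¬ᶠ (φ * ρ)
(φ ∨ᶠ ψ) * ρ = (φ * ρ) ∨ᶠ (ψ * ρ)
(φ ∧ᶠ ψ) * ρ = (φ * ρ) ∧ᶠ (ψ * ρ)
(◇ φ)    * ρ = ρ ⟨ φ * ρ ⟩

Rp1 : List Fm
Rp1 =
  concatMap (λ l → map (λ t → l ↔ᶠ t)
      (𝟙 ∷ e ∷ (e ∨ᶠ ◇ (¬ᶠ e)) ∷ (e ∨ᶠ ¬ᶠ ◇ (¬ᶠ e))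
         ∷ (¬ᶠ e ∨ᶠ ◇ (¬ᶠ e)) ∷ (¬ᶠ e ∨ᶠ ¬ᶠ ◇ (¬ᶠ e)) ∷ []))
    ((◇ e) ∷ (¬ᶠ ◇ e) ∷ [])
  ++
  concatMap (λ l → map (λ t → l ↔ᶠ t)
      (𝟙 ∷ e ∷ (e ∨ᶠ ◇ e) ∷ (e ∨ᶠ ¬ᶠ ◇ e)
         ∷ (¬ᶠ e ∨ᶠ ◇ e) ∷ (¬ᶠ e ∨ᶠ ¬ᶠ ◇ e) ∷ []))
    ((◇ (¬ᶠ e)) ∷ (¬ᶠ ◇ (¬ᶠ e)) ∷ [])

PartA : Fm → ℕ → ℕ → Set
PartA ρ v d = Σ (Fin (N v d) → Fin (N v d)) λ f →
  (∀ i → μ v d i * ρ ≈ μ v d (f i)) × Bijective _≡_ _≡_ f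

-- ω * ρ = { μ * ρ : μ ∈ ω }  (as the set of minterms ≈ some μ * ρ, μ ∈ ω)
orbMul : (v d : ℕ) → MSet v d → Fm → MSet v d
orbMul v d ω ρ j = Σ (Fin (N v d)) λ i → ω i × (μ v d i * ρ ≈ μ v d j)

PartB : Fm → ℕ → ℕ → Set₁
PartB ρ v d =
  (∀ ω → IsPrimeOrbit v d ω → IsPrimeOrbit v d (orbMul v d ω ρ)) ×
  (∀ ω₁ ω₂ → IsPrimeOrbit v d ω₁ → IsPrimeOrbit v d ω₂ →
      SameSet v d (orbMul v d ω₁ ρ) (orbMul v d ω₂ ρ) → SameSet v d ω₁ ω₂) ×
  (∀ ω' → IsPrimeOrbit v d ω' →
      Σ (MSet v d) λ ω → IsPrimeOrbit v d ω × (SameSet v d (orbMul v d ω ρ) ω'))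

module Submission where

-- Each ρ ∈ R_p(1) has an inverse ρ' ∈ R_p(1): ρ * ρ' and ρ' * ρ have degree ≤ 1 and evaluate like ◇e
-- under every valuation in which ◇ψ depends only on the truth table of ψ (a finite check). The level-d
-- minterms are the worlds of a finite canonical model in which every formula of 𝓕(v,d) is E-equivalent
-- to the DCF of its truth set, so formulas of 𝓕(v,d) holding at the same worlds are E-equivalent. In
-- this model φ * ρ holds at w iff φ holds at a translated world t_ρ(w), and t_ρ' inverts t_ρ; hence
-- μ * ρ ≈ minterm of t_ρ'(μ), a permutation of the minterms whose inverse comes from ρ'. Since * commutes
-- with prime substitutions, both permutations preserve the orbit relation, which gives (b).

open import Defs
open import Data.Bool using (Bool; true; false; _∧_; _∨_; not; if_then_else_)
open import Data.Bool.ListAction using (and; or)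
open import Data.Bool.Properties using (_≟_; ∧-identityʳ; ∨-identityʳ; ∧-zeroʳ)
open import Data.Empty using (⊥; ⊥-elim)
open import Data.Fin using (Fin; zero; suc)
open import Data.List
  using (List; []; _∷_; [_]; _++_; map; length; lookup; zipWith; concatMap; upTo; applyUpTo;
         cartesianProduct; cartesianProductWith)
open import Data.List.Properties
  using (map-cong; map-cong-local; map-id; length-map; map-++; map-∘; map-upTo; length-upTo;
         concatMap-map; map-concatMap; concatMap-cong; concatMap-pure; ∷-injectiveˡ; ∷-injectiveʳ)
open import Data.List.Membership.Propositional using (_∈_)
open import Data.List.Membership.Propositional.Properties
  using (∈-map⁺; ∈-map⁻; ∈-++⁺ˡ; ∈-++⁺ʳ; ∈-++⁻; ∈-upTo⁻; ∈-cartesianProduct⁺; ∈-cartesianProduct⁻;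
         ∈-cartesianProductWith⁺; ∈-cartesianProductWith⁻)
open import Data.List.Relation.Unary.All as All using (All; []; _∷_)
open import Data.List.Relation.Unary.All.Properties using (map⁺)
open import Data.List.Relation.Unary.Any as Any using (Any; here; there)
open import Data.List.Relation.Unary.Unique.Propositional using (Unique; []; _∷_)
import Data.List.Relation.Unary.Unique.Propositional.Properties as Unique
open import Data.Nat using (ℕ; zero; suc; _<_; _<?_; s≤s)
open import Data.Nat.Properties using (suc-injective)
open import Data.Product using (Σ; _×_; _,_; proj₁; proj₂; uncurry)
open import Data.Sum using (inj₁; inj₂)
open import Data.Unit using (⊤; tt)
open import Function using (_∘_)
open import Function.Bundles using (_⇔_; mk⇔; Equivalence; mk↔ₛ′; Bijection)
open import Function.Properties.Equivalence using (⇔-setoid) renaming (refl to ⇔-refl)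
open import Function.Properties.Inverse using (↔⇒⤖)
open import Level using (0ℓ)
import Relation.Binary.Reasoning.Setoid as SetoidReasoning
open import Relation.Binary.PropositionalEquality
  using (_≡_; _≢_; refl; sym; trans; cong; cong₂; subst; subst₂; module ≡-Reasoning)
open import Relation.Nullary using (Dec; yes; no; ¬_)
open import Relation.Nullary.Decidable using (map′; _×-dec_; toWitness)

private
  variable
    φ ψ χ X Y X' Y' ρ ρ' : Fm
    a a' : ℕ → Bool
    m m' : Fm → Bool
    v d : ℕ

≡⇒↔ᵇ : ∀ x y → x ≡ y → (not x ∨ y) ∧ (not y ∨ x) ≡ true
≡⇒↔ᵇ true  _ refl = refl
≡⇒↔ᵇ false _ refl = refl

↔ᵇ⇒≡ : ∀ x y → (not x ∨ y) ∧ (not y ∨ x) ≡ true → x ≡ y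
↔ᵇ⇒≡ true  true  _ = refl
↔ᵇ⇒≡ false false _ = refl
↔ᵇ⇒≡ true  false ()
↔ᵇ⇒≡ false true  ()

→ᵇ-intro : ∀ x y → (x ≡ true → y ≡ true) → not x ∨ y ≡ true
→ᵇ-intro true  y h = h refl
→ᵇ-intro false y h = refl

⊢E-tautological : ⊢E X → (∀ a m → eval a m X ≡ true → eval a m Y ≡ true) → ⊢E Y
⊢E-tautological ⊢X h = mp ⊢X (taut λ a m → →ᵇ-intro _ _ (h a m))

⊢E-tautological₂ : ⊢E X → ⊢E Y →
  (∀ a m → eval a m X ≡ true → eval a m Y ≡ true → eval a m φ ≡ true) → ⊢E φ
⊢E-tautological₂ ⊢X ⊢Y h =
  mp ⊢Y (mp ⊢X (taut λ a m → →ᵇ-intro _ _ λ x → →ᵇ-intro _ _ (h a m x)))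

≈-semantic : (∀ a m → eval a m X ≡ eval a m Y) → X ≈ Y
≈-semantic h = taut λ a m → ≡⇒↔ᵇ _ _ (h a m)

≈-lift₁ : X ≈ Y →
  (∀ a m → eval a m X ≡ eval a m Y → eval a m X' ≡ eval a m Y') → X' ≈ Y'
≈-lift₁ X≈Y h = ⊢E-tautological X≈Y λ a m t → ≡⇒↔ᵇ _ _ (h a m (↔ᵇ⇒≡ _ _ t))

≈-lift₂ : X ≈ Y → X' ≈ Y' →
  (∀ a m → eval a m X ≡ eval a m Y → eval a m X' ≡ eval a m Y' →
           eval a m φ ≡ eval a m ψ) → φ ≈ ψ
≈-lift₂ X≈Y X'≈Y' h = ⊢E-tautological₂ X≈Y X'≈Y' λ a m t t' →
  ≡⇒↔ᵇ _ _ (h a m (↔ᵇ⇒≡ _ _ t) (↔ᵇ⇒≡ _ _ t'))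

≈-refl : X ≈ X
≈-refl = ≈-semantic λ _ _ → refl

≈-sym : X ≈ Y → Y ≈ X
≈-sym X≈Y = ≈-lift₁ X≈Y λ _ _ → sym

≈-trans : X ≈ Y → Y ≈ φ → X ≈ φ
≈-trans X≈Y Y≈φ = ≈-lift₂ X≈Y Y≈φ λ _ _ → trans

¬ᶠ-cong : X ≈ Y → ¬ᶠ X ≈ ¬ᶠ Y
¬ᶠ-cong X≈Y = ≈-lift₁ X≈Y λ _ _ → cong not

∨ᶠ-cong : X ≈ Y → X' ≈ Y' → X ∨ᶠ X' ≈ Y ∨ᶠ Y'
∨ᶠ-cong X≈Y X'≈Y' = ≈-lift₂ X≈Y X'≈Y' λ _ _ → cong₂ _∨_

∧ᶠ-cong : X ≈ Y → X' ≈ Y' → X ∧ᶠ X' ≈ Y ∧ᶠ Y'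
∧ᶠ-cong X≈Y X'≈Y' = ≈-lift₂ X≈Y X'≈Y' λ _ _ → cong₂ _∧_

⟨⟩-cong : ∀ χ → X ≈ Y → χ ⟨ X ⟩ ≈ χ ⟨ Y ⟩
⟨⟩-cong (var i)  X≈Y = X≈Y
⟨⟩-cong 𝟘        X≈Y = ≈-refl
⟨⟩-cong 𝟙        X≈Y = ≈-refl
⟨⟩-cong (¬ᶠ χ)   X≈Y = ¬ᶠ-cong (⟨⟩-cong χ X≈Y)
⟨⟩-cong (χ ∨ᶠ ψ) X≈Y = ∨ᶠ-cong (⟨⟩-cong χ X≈Y) (⟨⟩-cong ψ X≈Y)
⟨⟩-cong (χ ∧ᶠ ψ) X≈Y = ∧ᶠ-cong (⟨⟩-cong χ X≈Y) (⟨⟩-cong ψ X≈Y)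
⟨⟩-cong (◇ χ)    X≈Y = re (⟨⟩-cong χ X≈Y)

sub-sub : ∀ σ τ φ → sub σ (sub τ φ) ≡ sub (sub σ ∘ τ) φ
sub-sub σ τ (var i)  = refl
sub-sub σ τ 𝟘        = refl
sub-sub σ τ 𝟙        = refl
sub-sub σ τ (¬ᶠ φ)   = cong ¬ᶠ_ (sub-sub σ τ φ)
sub-sub σ τ (φ ∨ᶠ ψ) = cong₂ _∨ᶠ_ (sub-sub σ τ φ) (sub-sub σ τ ψ)
sub-sub σ τ (φ ∧ᶠ ψ) = cong₂ _∧ᶠ_ (sub-sub σ τ φ) (sub-sub σ τ ψ)
sub-sub σ τ (◇ φ)    = cong ◇_ (sub-sub σ τ φ)

sub-cong : ∀ {σ τ} → (∀ i → σ i ≡ τ i) → ∀ φ → sub σ φ ≡ sub τ φ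
sub-cong σ≗τ (var i)  = σ≗τ i
sub-cong σ≗τ 𝟘        = refl
sub-cong σ≗τ 𝟙        = refl
sub-cong σ≗τ (¬ᶠ φ)   = cong ¬ᶠ_ (sub-cong σ≗τ φ)
sub-cong σ≗τ (φ ∨ᶠ ψ) = cong₂ _∨ᶠ_ (sub-cong σ≗τ φ) (sub-cong σ≗τ ψ)
sub-cong σ≗τ (φ ∧ᶠ ψ) = cong₂ _∧ᶠ_ (sub-cong σ≗τ φ) (sub-cong σ≗τ ψ)
sub-cong σ≗τ (◇ φ)    = cong ◇_ (sub-cong σ≗τ φ)

eval-sub : ∀ σ φ → eval a m (sub σ φ) ≡ eval (eval a m ∘ σ) (m ∘ sub σ) φ
eval-sub σ (var i)  = refl
eval-sub σ 𝟘        = refl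
eval-sub σ 𝟙        = refl
eval-sub σ (¬ᶠ φ)   = cong not (eval-sub σ φ)
eval-sub σ (φ ∨ᶠ ψ) = cong₂ _∨_ (eval-sub σ φ) (eval-sub σ ψ)
eval-sub σ (φ ∧ᶠ ψ) = cong₂ _∧_ (eval-sub σ φ) (eval-sub σ ψ)
eval-sub σ (◇ φ)    = refl

*-sub : ∀ σ φ → sub σ φ * ρ ≡ sub (λ i → σ i * ρ) (φ * ρ)
*-sub σ (var i)  = refl
*-sub σ 𝟘        = refl
*-sub σ 𝟙        = refl
*-sub σ (¬ᶠ φ)   = cong ¬ᶠ_ (*-sub σ φ)
*-sub σ (φ ∨ᶠ ψ) = cong₂ _∨ᶠ_ (*-sub σ φ) (*-sub σ ψ)
*-sub σ (φ ∧ᶠ ψ) = cong₂ _∧ᶠ_ (*-sub σ φ) (*-sub σ ψ)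
*-sub {ρ} σ (◇ φ) =
  trans (cong (_⟨_⟩ ρ) (*-sub σ φ)) (sym (sub-sub (λ i → σ i * ρ) _ ρ))

*-* : ∀ φ → (φ * ρ) * ρ' ≡ φ * (ρ * ρ')
*-* (var i)  = refl
*-* 𝟘        = refl
*-* 𝟙        = refl
*-* (¬ᶠ φ)   = cong ¬ᶠ_ (*-* φ)
*-* (φ ∨ᶠ ψ) = cong₂ _∨ᶠ_ (*-* φ) (*-* ψ)
*-* (φ ∧ᶠ ψ) = cong₂ _∧ᶠ_ (*-* φ) (*-* ψ)
*-* {ρ} {ρ'} (◇ φ) =
  trans (*-sub (λ _ → φ * ρ) ρ) (cong (_⟨_⟩ (ρ * ρ')) (*-* φ))

eval-* : ∀ φ → eval a m (φ * ρ) ≡ eval a (λ ψ → eval a m (ρ ⟨ ψ * ρ ⟩)) φ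
eval-* (var i)  = refl
eval-* 𝟘        = refl
eval-* 𝟙        = refl
eval-* (¬ᶠ φ)   = cong not (eval-* φ)
eval-* (φ ∨ᶠ ψ) = cong₂ _∨_ (eval-* φ) (eval-* ψ)
eval-* (φ ∧ᶠ ψ) = cong₂ _∧_ (eval-* φ) (eval-* ψ)
eval-* (◇ φ)    = refl

⊢E-* : ⊢E φ → ⊢E (φ * ρ)
⊢E-* {φ} (taut t)    = taut λ a m → trans (eval-* φ) (t a _)
⊢E-* (mp ⊢φ ⊢φ→ψ)   = mp (⊢E-* ⊢φ) (⊢E-* ⊢φ→ψ)
⊢E-* (us {φ} σ ⊢φ)   = subst ⊢E (sym (*-sub σ φ)) (us _ (⊢E-* ⊢φ))
⊢E-* {ρ = ρ} (re ⊢φ) = ⟨⟩-cong ρ (⊢E-* ⊢φ)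

*-NonModal : NonModal v φ → φ * ρ ≡ φ
*-NonModal (nm-var i) = refl
*-NonModal nm-0       = refl
*-NonModal nm-1       = refl
*-NonModal (nm-¬ p)   = cong ¬ᶠ_ (*-NonModal p)
*-NonModal (nm-∨ p q) = cong₂ _∨ᶠ_ (*-NonModal p) (*-NonModal q)
*-NonModal (nm-∧ p q) = cong₂ _∧ᶠ_ (*-NonModal p) (*-NonModal q)

∘ˢ-* : ∀ {ς : Subst0 v} → IsLevel0Subst v ς → ∀ φ → (φ ∘ˢ ς) * ρ ≡ (φ * ρ) ∘ˢ ς
∘ˢ-* {v} {ρ} {ς} ς-nm φ = trans (*-sub (ext ς) φ) (sub-cong ext-* (φ * ρ))
  where
  ext-* : ∀ k → ext ς k * ρ ≡ ext ς k
  ext-* k with k <? v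
  ... | yes k<v = *-NonModal (ς-nm _)
  ... | no  _   = refl

data Comb (V : ℕ → Set) (Q : Fm → Set) : Fm → Set where
  var   : ∀ {i} → V i → Comb V Q (var i)
  𝟘     : Comb V Q 𝟘
  𝟙     : Comb V Q 𝟙
  ¬ᶠ_   : Comb V Q φ → Comb V Q (¬ᶠ φ)
  _∨ᶠ_  : Comb V Q φ → Comb V Q ψ → Comb V Q (φ ∨ᶠ ψ)
  _∧ᶠ_  : Comb V Q φ → Comb V Q ψ → Comb V Q (φ ∧ᶠ ψ)
  ◇_    : Q φ → Comb V Q (◇ φ)

module _ {V V' : ℕ → Set} {Q Q' : Fm → Set} where

  Comb-map : (∀ {i} → V i → V' i) → (∀ {ψ} → Q ψ → Q' ψ) → Comb V Q φ → Comb V' Q' φ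
  Comb-map f g (var p)  = var (f p)
  Comb-map f g 𝟘        = 𝟘
  Comb-map f g 𝟙        = 𝟙
  Comb-map f g (¬ᶠ p)   = ¬ᶠ Comb-map f g p
  Comb-map f g (p ∨ᶠ q) = Comb-map f g p ∨ᶠ Comb-map f g q
  Comb-map f g (p ∧ᶠ q) = Comb-map f g p ∧ᶠ Comb-map f g q
  Comb-map f g (◇ q)    = ◇ g q

  Comb-sub : ∀ {σ} → (∀ {i} → V i → Comb V' Q' (σ i)) → (∀ {ψ} → Q ψ → Q' (sub σ ψ)) →
             Comb V Q φ → Comb V' Q' (sub σ φ)
  Comb-sub f g (var p)  = f p
  Comb-sub f g 𝟘        = 𝟘
  Comb-sub f g 𝟙        = 𝟙
  Comb-sub f g (¬ᶠ p)   = ¬ᶠ Comb-sub f g p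
  Comb-sub f g (p ∨ᶠ q) = Comb-sub f g p ∨ᶠ Comb-sub f g q
  Comb-sub f g (p ∧ᶠ q) = Comb-sub f g p ∧ᶠ Comb-sub f g q
  Comb-sub f g (◇ q)    = ◇ g q

module _ {V : ℕ → Set} {Q : Fm → Set} where

  eval-local : Comb V Q φ → (∀ {i} → V i → a i ≡ a' i) → (∀ {ψ} → Q ψ → m ψ ≡ m' ψ) →
               eval a m φ ≡ eval a' m' φ
  eval-local (var p)  ha hm = ha p
  eval-local 𝟘        ha hm = refl
  eval-local 𝟙        ha hm = refl
  eval-local (¬ᶠ p)   ha hm = cong not (eval-local p ha hm)
  eval-local (p ∨ᶠ q) ha hm = cong₂ _∨_ (eval-local p ha hm) (eval-local q ha hm)
  eval-local (p ∧ᶠ q) ha hm = cong₂ _∧_ (eval-local p ha hm) (eval-local q ha hm)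
  eval-local (◇ q)    ha hm = hm q

  comb? : (∀ i → Dec (V i)) → (∀ ψ → Dec (Q ψ)) → ∀ φ → Dec (Comb V Q φ)
  comb? V? Q? (var i)  = map′ var (λ { (var p) → p }) (V? i)
  comb? V? Q? 𝟘        = yes 𝟘
  comb? V? Q? 𝟙        = yes 𝟙
  comb? V? Q? (¬ᶠ φ)   = map′ ¬ᶠ_ (λ { (¬ᶠ p) → p }) (comb? V? Q? φ)
  comb? V? Q? (φ ∨ᶠ ψ) =
    map′ (uncurry _∨ᶠ_) (λ { (p ∨ᶠ q) → p , q }) (comb? V? Q? φ ×-dec comb? V? Q? ψ)
  comb? V? Q? (φ ∧ᶠ ψ) =
    map′ (uncurry _∧ᶠ_) (λ { (p ∧ᶠ q) → p , q }) (comb? V? Q? φ ×-dec comb? V? Q? ψ)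
  comb? V? Q? (◇ φ)    = map′ ◇_ (λ { (◇ q) → q }) (Q? φ)

ModalFree : Fm → Set
ModalFree = Comb (λ _ → ⊤) (λ _ → ⊥)

Degree≤1 : Fm → Set
Degree≤1 = Comb (λ _ → ⊤) ModalFree

degree≤1? : ∀ χ → Dec (Degree≤1 χ)
degree≤1? = comb? (λ _ → yes tt) (comb? (λ _ → yes tt) (λ _ → no λ ()))

-- 𝓕 v d φ means φ ∈ 𝓕(v,d); Below v d ψ says that ◇ψ may occur in such a formula
𝓕 : ℕ → ℕ → Fm → Set
Below : ℕ → ℕ → Fm → Set
𝓕 v d = Comb (_< v) (Below v d)
Below v zero    _ = ⊥
Below v (suc d)   = 𝓕 v d

𝓕-suc : 𝓕 v d φ → 𝓕 v (suc d) φ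
Below-suc : Below v d φ → Below v (suc d) φ
𝓕-suc = Comb-map (λ p → p) Below-suc
Below-suc {d = zero} ()
Below-suc {d = suc d} = 𝓕-suc

⟨⟩-𝓕 : Degree≤1 χ → 𝓕 v d X → 𝓕 v (suc d) (χ ⟨ X ⟩)
⟨⟩-𝓕 χ-deg X-𝓕 = Comb-sub (λ _ → 𝓕-suc X-𝓕) (Comb-sub (λ _ → X-𝓕) λ ()) χ-deg

*-𝓕 : Degree≤1 ρ → 𝓕 v d φ → 𝓕 v d (φ * ρ)
*-𝓕 ρ-deg (var p)  = var p
*-𝓕 ρ-deg 𝟘        = 𝟘
*-𝓕 ρ-deg 𝟙        = 𝟙
*-𝓕 ρ-deg (¬ᶠ p)   = ¬ᶠ *-𝓕 ρ-deg p
*-𝓕 ρ-deg (p ∨ᶠ q) = *-𝓕 ρ-deg p ∨ᶠ *-𝓕 ρ-deg q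
*-𝓕 ρ-deg (p ∧ᶠ q) = *-𝓕 ρ-deg p ∧ᶠ *-𝓕 ρ-deg q
*-𝓕 {d = suc d} ρ-deg (◇ q) = ⟨⟩-𝓕 ρ-deg (*-𝓕 ρ-deg q)

module _ {V : ℕ → Set} {Q : Fm → Set} where

  conj-Comb : ∀ {xs} → All (Comb V Q) xs → Comb V Q (conj xs)
  conj-Comb []               = 𝟙
  conj-Comb (p ∷ [])         = p
  conj-Comb (p ∷ ps@(_ ∷ _)) = p ∧ᶠ conj-Comb ps

  disj-Comb : ∀ {xs} → All (Comb V Q) xs → Comb V Q (disj xs)
  disj-Comb []               = 𝟘
  disj-Comb (p ∷ [])         = p
  disj-Comb (p ∷ ps@(_ ∷ _)) = p ∨ᶠ disj-Comb ps

literal : Fm → Bool → Fm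
literal x b = if b then x else ¬ᶠ x

sign : List Fm → List Bool → List Fm
sign = zipWith literal

choose : {A : Set} → List A → List Bool → List A
choose (x ∷ xs) (true  ∷ b) = x ∷ choose xs b
choose (x ∷ xs) (false ∷ b) = choose xs b
choose _        _           = []

bools : List Bool
bools = true ∷ false ∷ []

signVectors : ℕ → List (List Bool)
signVectors zero    = [] ∷ []
signVectors (suc n) = cartesianProductWith (λ bs b → b ∷ bs) (signVectors n) bools

subsetVectors : ℕ → List (List Bool)
subsetVectors zero    = [] ∷ []
subsetVectors (suc n) = map (true ∷_) (subsetVectors n) ++ map (false ∷_) (subsetVectors n)

cartesianProductWith-concatMap : ∀ {A B C : Set} (f : A → B → C) xs ys →
  cartesianProductWith f xs ys ≡ concatMap (λ x → map (f x) ys) xs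
cartesianProductWith-concatMap f []       ys = refl
cartesianProductWith-concatMap f (x ∷ xs) ys =
  cong (map (f x) ys ++_) (cartesianProductWith-concatMap f xs ys)

signings-signVectors : ∀ xs → signings xs ≡ map (sign xs) (signVectors (length xs))
signings-signVectors []       = refl
signings-signVectors (x ∷ xs) = begin
  concatMap pair (signings xs)
    ≡⟨ cong (concatMap pair) (signings-signVectors xs) ⟩
  concatMap pair (map (sign xs) S)
    ≡⟨ concatMap-map pair (sign xs) S ⟩
  concatMap (λ bs → map (sign (x ∷ xs)) (map (_∷ bs) bools)) S
    ≡⟨ map-concatMap (sign (x ∷ xs)) (λ bs → map (_∷ bs) bools) S ⟨
  map (sign (x ∷ xs)) (concatMap (λ bs → map (_∷ bs) bools) S)
    ≡⟨ cong (map (sign (x ∷ xs))) (cartesianProductWith-concatMap _ S bools) ⟨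
  map (sign (x ∷ xs)) (signVectors (length (x ∷ xs))) ∎
  where
  open ≡-Reasoning
  S = signVectors (length xs)
  pair : List Fm → List (List Fm)
  pair s = (x ∷ s) ∷ (¬ᶠ x ∷ s) ∷ []

subsets-subsetVectors : ∀ {A : Set} (xs : List A) →
                        subsets xs ≡ map (choose xs) (subsetVectors (length xs))
subsets-subsetVectors []       = refl
subsets-subsetVectors (x ∷ xs) = begin
  map (x ∷_) (subsets xs) ++ subsets xs
    ≡⟨ cong (λ s → map (x ∷_) s ++ s) (subsets-subsetVectors xs) ⟩
  map (x ∷_) (map (choose xs) S) ++ map (choose xs) S
    ≡⟨ cong (_++ map (choose xs) S) (map-∘ S) ⟨
  map (λ b → x ∷ choose xs b) S ++ map (choose xs) S
    ≡⟨ cong₂ _++_ (map-∘ S) (map-∘ S) ⟩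
  map (choose (x ∷ xs)) (map (true ∷_) S) ++ map (choose (x ∷ xs)) (map (false ∷_) S)
    ≡⟨ map-++ (choose (x ∷ xs)) (map (true ∷_) S) _ ⟨
  map (choose (x ∷ xs)) (subsetVectors (length (x ∷ xs))) ∎
  where
  open ≡-Reasoning
  S = subsetVectors (length xs)

∈-bools : ∀ b → b ∈ bools
∈-bools true  = here refl
∈-bools false = there (here refl)

∈-signVectors⁺ : ∀ bs → bs ∈ signVectors (length bs)
∈-signVectors⁺ []       = here refl
∈-signVectors⁺ (b ∷ bs) = ∈-cartesianProductWith⁺ _ (∈-signVectors⁺ bs) (∈-bools b)

∈-signVectors⁻ : ∀ n {bs} → bs ∈ signVectors n → length bs ≡ n
∈-signVectors⁻ zero    (here refl) = refl
∈-signVectors⁻ (suc n) p with _ , _ , bs∈ , _ , refl ← ∈-cartesianProductWith⁻ _ (signVectors n) bools p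
  = cong suc (∈-signVectors⁻ n bs∈)

∈-subsetVectors⁺ : ∀ bs → bs ∈ subsetVectors (length bs)
∈-subsetVectors⁺ []           = here refl
∈-subsetVectors⁺ (true ∷ bs)  = ∈-++⁺ˡ (∈-map⁺ (true ∷_) (∈-subsetVectors⁺ bs))
∈-subsetVectors⁺ (false ∷ bs) = ∈-++⁺ʳ _ (∈-map⁺ (false ∷_) (∈-subsetVectors⁺ bs))

∈-subsetVectors⁻ : ∀ n {bs} → bs ∈ subsetVectors n → length bs ≡ n
∈-subsetVectors⁻ zero    (here refl) = refl
∈-subsetVectors⁻ (suc n) p with ∈-++⁻ (map (true ∷_) (subsetVectors n)) p
... | inj₁ q with _ , bs∈ , refl ← ∈-map⁻ (true ∷_) q  = cong suc (∈-subsetVectors⁻ n bs∈)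
... | inj₂ q with _ , bs∈ , refl ← ∈-map⁻ (false ∷_) q = cong suc (∈-subsetVectors⁻ n bs∈)

signVectors-unique : ∀ n → Unique (signVectors n)
signVectors-unique zero    = [] ∷ []
signVectors-unique (suc n) =
  Unique.cartesianProductWith⁺ _ (λ eq → ∷-injectiveʳ eq , ∷-injectiveˡ eq)
    (signVectors-unique n) (((λ ()) ∷ []) ∷ [] ∷ [])

subsetVectors-unique : ∀ n → Unique (subsetVectors n)
subsetVectors-unique zero    = [] ∷ []
subsetVectors-unique (suc n) =
  Unique.++⁺ (Unique.map⁺ ∷-injectiveʳ (subsetVectors-unique n))
             (Unique.map⁺ ∷-injectiveʳ (subsetVectors-unique n)) disjoint
  where
  disjoint : ∀ {bs} → ¬ (bs ∈ map (true ∷_) (subsetVectors n) × bs ∈ map (false ∷_) (subsetVectors n))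
  disjoint (p , q) with _ , _ , refl ← ∈-map⁻ (true ∷_) p with _ , _ , () ← ∈-map⁻ (false ∷_) q

infix 4 _==_ _==ˡ_

_==_ : Bool → Bool → Bool
true  == b = b
false == b = not b

_==ˡ_ : List Bool → List Bool → Bool
[]       ==ˡ []       = true
(x ∷ xs) ==ˡ (y ∷ ys) = (x == y) ∧ (xs ==ˡ ys)
_        ==ˡ _        = false

==-refl : ∀ b → (b == b) ≡ true
==-refl true  = refl
==-refl false = refl

==-sound : ∀ {b c} → (b == c) ≡ true → b ≡ c
==-sound {true}  {true}  _ = refl
==-sound {false} {false} _ = refl

==ˡ-refl : ∀ bs → (bs ==ˡ bs) ≡ true
==ˡ-refl []       = refl
==ˡ-refl (b ∷ bs) rewrite ==-refl b = ==ˡ-refl bs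

∧-true : ∀ {b c} → b ∧ c ≡ true → b ≡ true × c ≡ true
∧-true {true} {true} _ = refl , refl

==ˡ-sound : ∀ {bs cs} → (bs ==ˡ cs) ≡ true → bs ≡ cs
==ˡ-sound {[]}     {[]}     _  = refl
==ˡ-sound {_ ∷ _}  {_ ∷ _}  eq = cong₂ _∷_ (==-sound (proj₁ (∧-true eq))) (==ˡ-sound (proj₂ (∧-true eq)))

map-≡-∈ : ∀ {A B : Set} {f g : A → B} {xs x} → map f xs ≡ map g xs → x ∈ xs → f x ≡ g x
map-≡-∈ eq (here refl) = ∷-injectiveˡ eq
map-≡-∈ eq (there x∈)  = map-≡-∈ (∷-injectiveʳ eq) x∈

-- chosen b L k: the entry of b at the position of k in L
module Choice {A : Set} (_≟ᵇ_ : A → A → Bool)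
              (≟ᵇ-refl : ∀ x → (x ≟ᵇ x) ≡ true) (≟ᵇ-sound : ∀ {x y} → (x ≟ᵇ y) ≡ true → x ≡ y) where

  ≢⇒≟ᵇ-false : ∀ {x y} → x ≢ y → (x ≟ᵇ y) ≡ false
  ≢⇒≟ᵇ-false {x} {y} x≢y with x ≟ᵇ y in eq
  ... | true  = ⊥-elim (x≢y (≟ᵇ-sound eq))
  ... | false = refl

  ≡⇒≟ᵇ-true : ∀ {x y} → x ≡ y → (x ≟ᵇ y) ≡ true
  ≡⇒≟ᵇ-true refl = ≟ᵇ-refl _

  ≟ᵇ-transpose : ∀ {f g : A → A} {x y} → f (g x) ≡ x → g (f y) ≡ y → (x ≟ᵇ f y) ≡ (g x ≟ᵇ y)
  ≟ᵇ-transpose {f} {g} {x} {y} fgx gfy with x ≟ᵇ f y in eq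
  ... | true  = sym (≡⇒≟ᵇ-true (trans (cong g (≟ᵇ-sound eq)) gfy))
  ... | false = sym (≢⇒≟ᵇ-false gx≢y)
    where
    gx≢y : g x ≢ y
    gx≢y gx≡y with () ← trans (sym (≡⇒≟ᵇ-true (trans (sym fgx) (cong f gx≡y)))) eq

  chosen : List Bool → List A → A → Bool
  chosen b L k = or (zipWith _∧_ b (map (_≟ᵇ k) L))

  chosen-∉ : ∀ {x L} b → All (x ≢_) L → chosen b L x ≡ false
  chosen-∉ []      _           = refl
  chosen-∉ (β ∷ b) []          = refl
  chosen-∉ (β ∷ b) (x≢c ∷ x∉L) rewrite ≢⇒≟ᵇ-false (x≢c ∘ sym) | ∧-zeroʳ β = chosen-∉ b x∉L

  map-chosen : ∀ {L} b → Unique L → length b ≡ length L → map (chosen b L) L ≡ b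
  map-chosen []      []           _   = refl
  map-chosen {x ∷ L} (β ∷ b) (x∉L ∷ L!) len = cong₂ _∷_ head tail
    where
    head : (β ∧ (x ≟ᵇ x)) ∨ chosen b L x ≡ β
    head rewrite ≟ᵇ-refl x | chosen-∉ b x∉L | ∧-identityʳ β = ∨-identityʳ β
    skip : ∀ {k} → x ≢ k → chosen (β ∷ b) (x ∷ L) k ≡ chosen b L k
    skip x≢k rewrite ≢⇒≟ᵇ-false x≢k | ∧-zeroʳ β = refl
    tail : map (chosen (β ∷ b) (x ∷ L)) L ≡ b
    tail = trans (map-cong-local (All.map skip x∉L)) (map-chosen b L! (suc-injective len))

  chosen-map : ∀ {L k} (g : A → Bool) → Unique L → k ∈ L → chosen (map g L) L k ≡ g k
  chosen-map {L} g L! = map-≡-∈ (map-chosen (map g L) L! (length-map g L))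

eval-conj : ∀ xs → eval a m (conj xs) ≡ and (map (eval a m) xs)
eval-conj []           = refl
eval-conj (x ∷ [])     = sym (∧-identityʳ _)
eval-conj (x ∷ y ∷ xs) = cong (_ ∧_) (eval-conj (y ∷ xs))

eval-disj : ∀ xs → eval a m (disj xs) ≡ or (map (eval a m) xs)
eval-disj []           = refl
eval-disj (x ∷ [])     = sym (∨-identityʳ _)
eval-disj (x ∷ y ∷ xs) = cong (_ ∨_) (eval-disj (y ∷ xs))

eval-literal : ∀ x b → eval a m (literal x b) ≡ (b == eval a m x)
eval-literal x true  = refl
eval-literal x false = refl

and-sign : ∀ xs bs → length bs ≡ length xs →
           and (map (eval a m) (sign xs bs)) ≡ (bs ==ˡ map (eval a m) xs)
and-sign []       []       _   = refl
and-sign (x ∷ xs) (b ∷ bs) len = cong₂ _∧_ (eval-literal x b) (and-sign xs bs (suc-injective len))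

eval-conj-sign : ∀ xs bs → length bs ≡ length xs →
                 eval a m (conj (sign xs bs)) ≡ (bs ==ˡ map (eval a m) xs)
eval-conj-sign xs bs len = trans (eval-conj (sign xs bs)) (and-sign xs bs len)

or-choose : ∀ {A : Set} (f : A → Bool) xs b → or (map f (choose xs b)) ≡ or (zipWith _∧_ b (map f xs))
or-choose f []       []          = refl
or-choose f []       (_ ∷ _)     = refl
or-choose f (x ∷ xs) []          = refl
or-choose f (x ∷ xs) (true  ∷ b) = cong (f x ∨_) (or-choose f xs b)
or-choose f (x ∷ xs) (false ∷ b) = or-choose f xs b

eval-disj-choose : ∀ xs b → eval a m (disj (choose xs b)) ≡ or (zipWith _∧_ b (map (eval a m) xs))
eval-disj-choose {a} {m} xs b = trans (eval-disj (choose xs b)) (or-choose (eval a m) xs b)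

sign-All : ∀ {P : Fm → Set} {xs} → (∀ {x} → P x → P (¬ᶠ x)) → All P xs → ∀ bs → All P (sign xs bs)
sign-All P¬ []       _            = []
sign-All P¬ (p ∷ ps) []           = []
sign-All P¬ (p ∷ ps) (true  ∷ bs) = p ∷ sign-All P¬ ps bs
sign-All P¬ (p ∷ ps) (false ∷ bs) = P¬ p ∷ sign-All P¬ ps bs

choose-All : ∀ {A : Set} {P : A → Set} {xs} → All P xs → ∀ b → All P (choose xs b)
choose-All []       _           = []
choose-All (p ∷ ps) []          = []
choose-All (p ∷ ps) (true  ∷ b) = p ∷ choose-All ps b
choose-All (p ∷ ps) (false ∷ b) = choose-All ps b

truthAt : Bool → Fm → Bool
truthAt b = eval (λ _ → b) (λ _ → false)

-- ◇ψ, for ψ modal-free in e, valued by a function of the truth table of ψ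
byTable : (Bool → Bool → Bool) → Fm → Bool
byTable M ψ = M (truthAt true ψ) (truthAt false ψ)

truthAt-if : ∀ b ψ → truthAt b ψ ≡ (if b then truthAt true ψ else truthAt false ψ)
truthAt-if true  ψ = refl
truthAt-if false ψ = refl

map-if-id : ∀ bs → map (λ b → if b then true else false) bs ≡ bs
map-if-id bs = trans (map-cong (λ { true → refl ; false → refl }) bs) (map-id bs)

eval-⟨⟩-ModalFree : ModalFree ψ → eval a m (ψ ⟨ X ⟩) ≡ truthAt (eval a m X) ψ
eval-⟨⟩-ModalFree {ψ} ψ-mf = trans (eval-sub _ ψ) (eval-local ψ-mf (λ _ → refl) λ ())

eval-⟨⟩ : ∀ {M} → Degree≤1 χ → (∀ {ψ} → ModalFree ψ → m (ψ ⟨ X ⟩) ≡ byTable M ψ) →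
          eval a m (χ ⟨ X ⟩) ≡ eval (λ _ → eval a m X) (byTable M) χ
eval-⟨⟩ {χ} χ-deg hm = trans (eval-sub _ χ) (eval-local χ-deg (λ _ → refl) hm)

ActsLike◇ : Fm → Set
ActsLike◇ χ = ∀ x M → eval (λ _ → x) (byTable M) χ ≡ M true false

IdentityUR : Fm → Set
IdentityUR χ = Degree≤1 χ × ActsLike◇ χ

record InversePair (ρ ρ' : Fm) : Set where
  constructor inversePair
  field
    degree≤1ˡ : Degree≤1 ρ
    degree≤1ʳ : Degree≤1 ρ'
    identityˡ : IdentityUR (ρ * ρ')
    identityʳ : IdentityUR (ρ' * ρ)

InversePair-sym : InversePair ρ ρ' → InversePair ρ' ρ
InversePair-sym (inversePair ρ-deg ρ'-deg ρρ'-id ρ'ρ-id) = inversePair ρ'-deg ρ-deg ρ'ρ-id ρρ'-id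

-- The canonical model: a level-d world signs the atoms and the level-d modal factors

bitAt : List Bool → ℕ → Bool
bitAt []       _       = false
bitAt (b ∷ bs) zero    = b
bitAt (b ∷ bs) (suc i) = bitAt bs i

applyUpTo-bitAt : ∀ bs → applyUpTo (bitAt bs) (length bs) ≡ bs
applyUpTo-bitAt []       = refl
applyUpTo-bitAt (b ∷ bs) = cong (b ∷_) (applyUpTo-bitAt bs)

bitAt-applyUpTo : ∀ (f : ℕ → Bool) {n i} → i < n → bitAt (applyUpTo f n) i ≡ f i
bitAt-applyUpTo f {suc n} {zero}  _         = refl
bitAt-applyUpTo f {suc n} {suc i} (s≤s i<n) = bitAt-applyUpTo (f ∘ suc) i<n

World : Set
World = List Bool × List Bool

infix 4 _==ʷ_
_==ʷ_ : World → World → Bool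
(bs , ms) ==ʷ (bs' , ms') = (bs ==ˡ bs') ∧ (ms ==ˡ ms')

==ʷ-refl : ∀ w → (w ==ʷ w) ≡ true
==ʷ-refl (bs , ms) rewrite ==ˡ-refl bs = ==ˡ-refl ms

==ʷ-sound : ∀ {w w'} → (w ==ʷ w') ≡ true → w ≡ w'
==ʷ-sound eq = cong₂ _,_ (==ˡ-sound (proj₁ (∧-true eq))) (==ˡ-sound (proj₂ (∧-true eq)))

module Chooseˡ = Choice _==ˡ_ ==ˡ-refl ==ˡ-sound
module Chooseʷ = Choice _==ʷ_ ==ʷ-refl ==ʷ-sound

module Canonical (v : ℕ) where

  atoms : List Fm
  atoms = map var (upTo v)

  DCF : ℕ → List Bool → Fm
  DCF d T = disj (choose (minterms v d) T)

  indexVectors : ℕ → List (List Bool)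
  indexVectors d = subsetVectors (length (minterms v d))

  factors : ℕ → List Fm
  factors zero    = []
  factors (suc d) = map ◇_ (dcf (minterms v d))

  worlds : ℕ → List World
  worlds d = cartesianProduct (signVectors (length atoms)) (signVectors (length (factors d)))

  minterm : ℕ → World → Fm
  minterm zero    (bs , _)  = conj (sign atoms bs)
  minterm (suc d) (bs , ms) = conj (sign atoms bs) ∧ᶠ conj (sign (factors (suc d)) ms)

  -- ◇ψ holds at w iff w signs positively the factor ◇ (DCF of the truth set of ψ)
  sat : ℕ → World → Fm → Bool
  modal : ℕ → List Bool → Fm → Bool
  extension : ℕ → Fm → List Bool
  sat d w = eval (bitAt (proj₁ w)) (modal d (proj₂ w))
  modal zero    ms ψ = false
  modal (suc d) ms ψ = Chooseˡ.chosen ms (indexVectors d) (extension d ψ)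
  extension d ψ = map (λ w → sat d w ψ) (worlds d)

  world : ℕ → (Fm → Bool) → World
  world d I = map I atoms , map I (factors d)

  nf : ℕ → Fm → Fm
  nf d φ = DCF d (extension d φ)

  length-atoms : length atoms ≡ v
  length-atoms = trans (length-map var (upTo v)) (length-upTo v)

  factors-DCF : ∀ d → factors (suc d) ≡ map (◇_ ∘ DCF d) (indexVectors d)
  factors-DCF d = begin
    map ◇_ (map disj (subsets (minterms v d)))
      ≡⟨ cong (map ◇_ ∘ map disj) (subsets-subsetVectors (minterms v d)) ⟩
    map ◇_ (map disj (map (choose (minterms v d)) (indexVectors d)))
      ≡⟨ cong (map ◇_) (map-∘ (indexVectors d)) ⟨
    map ◇_ (map (DCF d) (indexVectors d))
      ≡⟨ map-∘ (indexVectors d) ⟨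
    map (◇_ ∘ DCF d) (indexVectors d) ∎
    where open ≡-Reasoning

  length-factors : ∀ d → length (factors (suc d)) ≡ length (indexVectors d)
  length-factors d = trans (cong length (factors-DCF d)) (length-map _ (indexVectors d))

  ∈-worlds⁺ : ∀ {d bs ms} → length bs ≡ length atoms → length ms ≡ length (factors d) →
              (bs , ms) ∈ worlds d
  ∈-worlds⁺ {bs = bs} {ms} |bs| |ms| = ∈-cartesianProduct⁺
    (subst (λ n → bs ∈ signVectors n) |bs| (∈-signVectors⁺ bs))
    (subst (λ n → ms ∈ signVectors n) |ms| (∈-signVectors⁺ ms))

  ∈-worlds⁻ : ∀ {d bs ms} → (bs , ms) ∈ worlds d →
              length bs ≡ length atoms × length ms ≡ length (factors d)
  ∈-worlds⁻ {d} w∈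
    with bs∈ , ms∈ ← ∈-cartesianProduct⁻ (signVectors (length atoms)) (signVectors (length (factors d))) w∈
    = ∈-signVectors⁻ _ bs∈ , ∈-signVectors⁻ _ ms∈

  worlds-unique : ∀ d → Unique (worlds d)
  worlds-unique d =
    Unique.cartesianProduct⁺ (signVectors-unique (length atoms)) (signVectors-unique (length (factors d)))

  world-∈ : ∀ d I → world d I ∈ worlds d
  world-∈ d I = ∈-worlds⁺ {d} (length-map I atoms) (length-map I (factors d))

  minterms-worlds : ∀ d → minterms v d ≡ map (minterm d) (worlds d)
  minterms-worlds d = trans (minterms-concatMap d) (sym map-minterm-worlds)
    where
    S = signVectors (length atoms)
    S' = signVectors (length (factors d))
    open ≡-Reasoning
    map-minterm-worlds : map (minterm d) (worlds d) ≡
                         concatMap (λ bs → map (λ ms → minterm d (bs , ms)) S') S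
    map-minterm-worlds = begin
      map (minterm d) (worlds d)
        ≡⟨ cong (map (minterm d)) (cartesianProductWith-concatMap _,_ S S') ⟩
      map (minterm d) (concatMap (λ bs → map (bs ,_) S') S)
        ≡⟨ map-concatMap (minterm d) (λ bs → map (bs ,_) S') S ⟩
      concatMap (λ bs → map (minterm d) (map (bs ,_) S')) S
        ≡⟨ concatMap-cong (λ bs → map-∘ S') S ⟨
      concatMap (λ bs → map (λ ms → minterm d (bs , ms)) S') S ∎
    minterms-concatMap : ∀ d → minterms v d ≡
      concatMap (λ bs → map (λ ms → minterm d (bs , ms)) (signVectors (length (factors d)))) S
    minterms-concatMap zero = begin
      map conj (signings atoms)                  ≡⟨ cong (map conj) (signings-signVectors atoms) ⟩
      map conj (map (sign atoms) S)              ≡⟨ map-∘ S ⟨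
      map (conj ∘ sign atoms) S                  ≡⟨ concatMap-pure _ ⟨
      concatMap [_] (map (conj ∘ sign atoms) S)  ≡⟨ concatMap-map [_] (conj ∘ sign atoms) S ⟩
      concatMap (λ bs → [ conj (sign atoms bs) ]) S ∎
    minterms-concatMap (suc d) = begin
      concatMap F (map conj (signings atoms))
        ≡⟨ cong (concatMap F ∘ map conj) (signings-signVectors atoms) ⟩
      concatMap F (map conj (map (sign atoms) S))   ≡⟨ concatMap-map F conj (map (sign atoms) S) ⟩
      concatMap (F ∘ conj) (map (sign atoms) S)     ≡⟨ concatMap-map (F ∘ conj) (sign atoms) S ⟩
      concatMap (F ∘ conj ∘ sign atoms) S           ≡⟨ concatMap-cong F-sign S ⟩
      concatMap (λ bs → map (λ ms → minterm (suc d) (bs , ms)) S'') S ∎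
      where
      S'' = signVectors (length (factors (suc d)))
      F : Fm → List Fm
      F m₀ = map (λ s → m₀ ∧ᶠ conj s) (signings (factors (suc d)))
      F-sign : ∀ bs → F (conj (sign atoms bs)) ≡ map (λ ms → minterm (suc d) (bs , ms)) S''
      F-sign bs = trans (cong (map _) (signings-signVectors (factors (suc d)))) (sym (map-∘ S''))

  length-worlds : ∀ d → length (worlds d) ≡ length (minterms v d)
  length-worlds d = sym (trans (cong length (minterms-worlds d)) (length-map (minterm d) (worlds d)))

  indexVectors-unique : ∀ d → Unique (indexVectors d)
  indexVectors-unique d = subsetVectors-unique (length (minterms v d))

  extension-∈ : ∀ d φ → extension d φ ∈ indexVectors d
  extension-∈ d φ = subst (λ n → extension d φ ∈ subsetVectors n)
    (trans (length-map _ (worlds d)) (length-worlds d)) (∈-subsetVectors⁺ (extension d φ))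

  bitAt-atoms : ∀ (I : Fm → Bool) {i} → i < v → bitAt (map I atoms) i ≡ I (var i)
  bitAt-atoms I {i} i<v = begin
    bitAt (map I (map var (upTo v))) i  ≡⟨ cong (λ bs → bitAt bs i) (map-∘ (upTo v)) ⟨
    bitAt (map (I ∘ var) (upTo v)) i    ≡⟨ cong (λ bs → bitAt bs i) (map-upTo (I ∘ var) v) ⟩
    bitAt (applyUpTo (I ∘ var) v) i     ≡⟨ bitAt-applyUpTo (I ∘ var) i<v ⟩
    I (var i)                           ∎
    where open ≡-Reasoning

  eval-minterm : ∀ d {w} → w ∈ worlds d → eval a m (minterm d w) ≡ (w ==ʷ world d (eval a m))
  eval-minterm zero {bs , []} w∈ =
    trans (eval-conj-sign atoms bs (proj₁ (∈-worlds⁻ {zero} w∈))) (sym (∧-identityʳ _))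
  eval-minterm zero {bs , _ ∷ _} w∈ with () ← proj₂ (∈-worlds⁻ {zero} w∈)
  eval-minterm (suc d) {bs , ms} w∈ =
    cong₂ _∧_ (eval-conj-sign atoms bs (proj₁ (∈-worlds⁻ {suc d} w∈)))
              (eval-conj-sign (factors (suc d)) ms (proj₂ (∈-worlds⁻ {suc d} w∈)))

  eval-DCF : ∀ d T → eval a m (DCF d T) ≡ Chooseʷ.chosen T (worlds d) (world d (eval a m))
  eval-DCF {a} {m} d T = begin
    eval a m (disj (choose (minterms v d) T))
      ≡⟨ eval-disj-choose (minterms v d) T ⟩
    or (zipWith _∧_ T (map (eval a m) (minterms v d)))
      ≡⟨ cong (λ ms → or (zipWith _∧_ T (map (eval a m) ms))) (minterms-worlds d) ⟩
    or (zipWith _∧_ T (map (eval a m) (map (minterm d) (worlds d))))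
      ≡⟨ cong (or ∘ zipWith _∧_ T) (map-∘ (worlds d)) ⟨
    or (zipWith _∧_ T (map (eval a m ∘ minterm d) (worlds d)))
      ≡⟨ cong (or ∘ zipWith _∧_ T) (map-cong-local (All.tabulate (eval-minterm d))) ⟩
    Chooseʷ.chosen T (worlds d) (world d (eval a m)) ∎
    where open ≡-Reasoning

  world-sat : ∀ d {w} → w ∈ worlds d → world d (sat d w) ≡ w
  extension-DCF : ∀ d {T} → length T ≡ length (worlds d) → extension d (DCF d T) ≡ T

  sat-DCF : ∀ d {w} T → w ∈ worlds d → sat d w (DCF d T) ≡ Chooseʷ.chosen T (worlds d) w
  sat-DCF d T w∈ = trans (eval-DCF d T) (cong (Chooseʷ.chosen T (worlds d)) (world-sat d w∈))

  extension-DCF d {T} |T| =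
    trans (map-cong-local (All.tabulate (sat-DCF d T))) (Chooseʷ.map-chosen T (worlds-unique d) |T|)

  world-sat d {bs , ms} w∈ = cong₂ _,_ atoms-sat (factors-sat d ms (proj₂ (∈-worlds⁻ {d} w∈)))
    where
    open ≡-Reasoning
    |bs| : length bs ≡ v
    |bs| = trans (proj₁ (∈-worlds⁻ {d} w∈)) length-atoms
    atoms-sat : map (sat d (bs , ms)) atoms ≡ bs
    atoms-sat = begin
      map (sat d (bs , ms)) (map var (upTo v))  ≡⟨ map-∘ (upTo v) ⟨
      map (bitAt bs) (upTo v)                   ≡⟨ map-upTo (bitAt bs) v ⟩
      applyUpTo (bitAt bs) v                    ≡⟨ cong (applyUpTo (bitAt bs)) |bs| ⟨
      applyUpTo (bitAt bs) (length bs)          ≡⟨ applyUpTo-bitAt bs ⟩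
      bs                                        ∎
    factors-sat : ∀ d ms → length ms ≡ length (factors d) → map (sat d (bs , ms)) (factors d) ≡ ms
    factors-sat zero    []       _    = refl
    factors-sat (suc d) ms       |ms| = begin
      map (sat (suc d) (bs , ms)) (factors (suc d))
        ≡⟨ cong (map (sat (suc d) (bs , ms))) (factors-DCF d) ⟩
      map (sat (suc d) (bs , ms)) (map (◇_ ∘ DCF d) (indexVectors d))
        ≡⟨ map-∘ (indexVectors d) ⟨
      map (λ T → Chooseˡ.chosen ms (indexVectors d) (extension d (DCF d T))) (indexVectors d)
        ≡⟨ map-cong-local (All.tabulate λ T∈ → cong (Chooseˡ.chosen ms (indexVectors d))
             (extension-DCF d (trans (∈-subsetVectors⁻ _ T∈) (sym (length-worlds d))))) ⟩
      map (Chooseˡ.chosen ms (indexVectors d)) (indexVectors d)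
        ≡⟨ Chooseˡ.map-chosen ms (indexVectors-unique d) (trans |ms| (length-factors d)) ⟩
      ms ∎

  eval-nf : ∀ d φ → eval a m (nf d φ) ≡ sat d (world d (eval a m)) φ
  eval-nf {a} {m} d φ =
    trans (eval-DCF d (extension d φ))
          (Chooseʷ.chosen-map (λ w → sat d w φ) (worlds-unique d) (world-∈ d (eval a m)))

  sat-nf : ∀ d φ {w} → w ∈ worlds d → sat d w (nf d φ) ≡ sat d w φ
  sat-nf d φ w∈ = trans (eval-nf d φ) (cong (λ w → sat d w φ) (world-sat d w∈))

  modal-world : ∀ d ψ → modal (suc d) (map (eval a m) (factors (suc d))) ψ ≡ m (nf d ψ)
  modal-world {a} {m} d ψ = begin
    Chooseˡ.chosen (map (eval a m) (factors (suc d))) (indexVectors d) (extension d ψ)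
      ≡⟨ cong (λ fs → Chooseˡ.chosen (map (eval a m) fs) (indexVectors d) (extension d ψ))
              (factors-DCF d) ⟩
    Chooseˡ.chosen (map (eval a m) (map (◇_ ∘ DCF d) (indexVectors d))) (indexVectors d) (extension d ψ)
      ≡⟨ cong (λ bs → Chooseˡ.chosen bs (indexVectors d) (extension d ψ)) (map-∘ (indexVectors d)) ⟨
    Chooseˡ.chosen (map (m ∘ DCF d) (indexVectors d)) (indexVectors d) (extension d ψ)
      ≡⟨ Chooseˡ.chosen-map (m ∘ DCF d) (indexVectors-unique d) (extension-∈ d ψ) ⟩
    m (nf d ψ) ∎
    where open ≡-Reasoning

  ≈-nf : 𝓕 v d φ → φ ≈ nf d φ
  ≈-nf {d} {var i} (var i<v) = ≈-semantic λ a m →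
    sym (trans (eval-nf d (var i)) (bitAt-atoms (eval a m) i<v))
  ≈-nf {d} 𝟘 = ≈-semantic λ _ _ → sym (eval-nf d 𝟘)
  ≈-nf {d} 𝟙 = ≈-semantic λ _ _ → sym (eval-nf d 𝟙)
  ≈-nf {d} {¬ᶠ φ} (¬ᶠ p) = ≈-trans (¬ᶠ-cong (≈-nf p)) (≈-semantic λ _ _ →
    trans (cong not (eval-nf d φ)) (sym (eval-nf d (¬ᶠ φ))))
  ≈-nf {d} {φ ∨ᶠ ψ} (p ∨ᶠ q) = ≈-trans (∨ᶠ-cong (≈-nf p) (≈-nf q)) (≈-semantic λ _ _ →
    trans (cong₂ _∨_ (eval-nf d φ) (eval-nf d ψ)) (sym (eval-nf d (φ ∨ᶠ ψ))))
  ≈-nf {d} {φ ∧ᶠ ψ} (p ∧ᶠ q) = ≈-trans (∧ᶠ-cong (≈-nf p) (≈-nf q)) (≈-semantic λ _ _ →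
    trans (cong₂ _∧_ (eval-nf d φ) (eval-nf d ψ)) (sym (eval-nf d (φ ∧ᶠ ψ))))
  ≈-nf {suc d} {◇ ψ} (◇ p) = ≈-trans (re (≈-nf p)) (≈-semantic λ _ _ →
    sym (trans (eval-nf (suc d) (◇ ψ)) (modal-world d ψ)))

  ≈-complete : 𝓕 v d φ → 𝓕 v d ψ → (∀ {w} → w ∈ worlds d → sat d w φ ≡ sat d w ψ) → φ ≈ ψ
  ≈-complete {d} {ψ = ψ} p q h =
    ≈-trans (≈-nf p) (subst (λ T → DCF d T ≈ ψ) (sym (map-cong-local (All.tabulate h))) (≈-sym (≈-nf q)))

  atoms-𝓕 : ∀ {d} → All (𝓕 v d) atoms
  atoms-𝓕 = map⁺ (All.tabulate λ i∈ → var (∈-upTo⁻ i∈))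

  minterms-𝓕 : ∀ d → All (𝓕 v d) (minterms v d)
  minterm-𝓕 : ∀ d w → 𝓕 v d (minterm d w)
  factors-𝓕 : ∀ d → All (𝓕 v d) (factors d)
  DCF-𝓕 : ∀ d T → 𝓕 v d (DCF d T)

  minterms-𝓕 d =
    subst (All (𝓕 v d)) (sym (minterms-worlds d)) (map⁺ (All.universal (minterm-𝓕 d) (worlds d)))
  minterm-𝓕 zero    (bs , _)  = conj-Comb (sign-All ¬ᶠ_ atoms-𝓕 bs)
  minterm-𝓕 (suc d) (bs , ms) =
    conj-Comb (sign-All ¬ᶠ_ atoms-𝓕 bs) ∧ᶠ conj-Comb (sign-All ¬ᶠ_ (factors-𝓕 (suc d)) ms)
  factors-𝓕 zero    = []
  factors-𝓕 (suc d) = subst (All (𝓕 v (suc d))) (sym (factors-DCF d))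
    (map⁺ (All.universal (λ T → ◇ DCF-𝓕 d T) (indexVectors d)))
  DCF-𝓕 d T = disj-Comb (choose-All (minterms-𝓕 d) T)

  world-cong : ∀ d {I J : Fm → Bool} → (∀ {φ} → 𝓕 v d φ → I φ ≡ J φ) → world d I ≡ world d J
  world-cong d I≗J =
    cong₂ _,_ (map-cong-local (All.map I≗J atoms-𝓕)) (map-cong-local (All.map I≗J (factors-𝓕 d)))

  Normal : ℕ → (Fm → Bool) → Set
  Normal zero    m = ⊤
  Normal (suc d) m = ∀ {ψ} → 𝓕 v d ψ → m ψ ≡ m (nf d ψ)

  eval-world : ∀ d → Normal d m → 𝓕 v d φ → eval a m φ ≡ sat d (world d (eval a m)) φ
  eval-world {m} {a = a} d normal p =
    eval-local p (λ i<v → sym (bitAt-atoms (eval a m) i<v)) (agree d normal)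
    where
    agree : ∀ d → Normal d m → ∀ {ψ} → Below v d ψ → m ψ ≡ modal d (map (eval a m) (factors d)) ψ
    agree zero    _      ()
    agree (suc d) normal {ψ} q = trans (normal q) (sym (modal-world d ψ))

  restrict : ℕ → World → World
  restrict d w = world d (sat (suc d) w)

  sat-restrict : ∀ d w → 𝓕 v d φ → sat (suc d) w φ ≡ sat d (restrict d w) φ
  extension-nf : ∀ d → 𝓕 v d ψ → extension (suc d) (nf d ψ) ≡ extension (suc d) ψ

  sat-restrict d w = eval-world d (normal d)
    where
    normal : ∀ d → Normal d (modal (suc d) (proj₂ w))
    normal zero    = tt
    normal (suc d) q = cong (Chooseˡ.chosen (proj₂ w) (indexVectors (suc d))) (sym (extension-nf d q))

  extension-nf {ψ} d q = map-cong (λ w → begin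
    sat (suc d) w (nf d ψ)        ≡⟨ sat-restrict d w (DCF-𝓕 d _) ⟩
    sat d (restrict d w) (nf d ψ) ≡⟨ sat-nf d ψ (world-∈ d _) ⟩
    sat d (restrict d w) ψ        ≡⟨ sat-restrict d w q ⟨
    sat (suc d) w ψ               ∎) (worlds (suc d))
    where open ≡-Reasoning

  extension-⟨⟩ : ∀ d → ModalFree ψ → extension d (ψ ⟨ X ⟩) ≡ map (λ b → truthAt b ψ) (extension d X)
  extension-⟨⟩ d q = trans (map-cong (λ w → eval-⟨⟩-ModalFree q) (worlds d)) (map-∘ (worlds d))

  tableAt : ℕ → World → List Bool → Bool → Bool → Bool
  tableAt d w E t f = Chooseˡ.chosen (proj₂ w) (indexVectors d) (map (λ b → if b then t else f) E)

  sat-⟨⟩ : ∀ d w → Degree≤1 χ →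
    sat (suc d) w (χ ⟨ X ⟩) ≡ eval (λ _ → sat (suc d) w X) (byTable (tableAt d w (extension d X))) χ
  sat-⟨⟩ {X = X} d w χ-deg = eval-⟨⟩ {M = tableAt d w (extension d X)} χ-deg λ {ψ} q →
    cong (Chooseˡ.chosen (proj₂ w) (indexVectors d))
         (trans (extension-⟨⟩ d q) (map-cong (λ b → truthAt-if b ψ) (extension d X)))

  sat-⟨⟩-cong : ∀ d w → Degree≤1 χ → sat (suc d) w X ≡ sat (suc d) w Y → extension d X ≡ extension d Y →
                sat (suc d) w (χ ⟨ X ⟩) ≡ sat (suc d) w (χ ⟨ Y ⟩)
  sat-⟨⟩-cong {χ} d w χ-deg same-here same-extension = trans (sat-⟨⟩ d w χ-deg) (trans
    (cong₂ (λ x E → eval (λ _ → x) (byTable (tableAt d w E)) χ) same-here same-extension)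
    (sym (sat-⟨⟩ d w χ-deg)))

  sat-identity : ∀ d w → IdentityUR χ → sat (suc d) w (χ ⟨ X ⟩) ≡ sat (suc d) w (◇ X)
  sat-identity {X = X} d w (χ-deg , χ-◇) = trans (sat-⟨⟩ d w χ-deg)
    (trans (χ-◇ (sat (suc d) w X) (tableAt d w (extension d X)))
           (cong (Chooseˡ.chosen (proj₂ w) (indexVectors d)) (map-if-id (extension d X))))

  sat-*-identity : IdentityUR χ → ∀ d w → 𝓕 v d φ → sat d w (φ * χ) ≡ sat d w φ
  sat-*-identity {χ} {φ} χ-id d w p = trans (eval-* φ) (eval-local p (λ _ → refl) (agree d))
    where
    agree : ∀ d → Below v d ψ → sat d w (χ ⟨ ψ * χ ⟩) ≡ modal d (proj₂ w) ψ
    agree zero    ()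
    agree (suc d) q = trans (sat-identity d w χ-id) (cong (Chooseˡ.chosen (proj₂ w) (indexVectors d))
      (map-cong (λ w' → sat-*-identity χ-id d w' q) (worlds d)))

  translate : Fm → ℕ → World → World
  translate ρ d w = world d (λ φ → sat d w (φ * ρ))

  sat-* : Degree≤1 ρ → ∀ d w → 𝓕 v d φ → sat d w (φ * ρ) ≡ sat d (translate ρ d w) φ
  sat-* {ρ} {φ} ρ-deg d w p = begin
    sat d w (φ * ρ)                               ≡⟨ eval-* φ ⟩
    eval (bitAt (proj₁ w)) mᵨ φ                   ≡⟨ eval-world d (normal d) p ⟩
    sat d (world d (eval (bitAt (proj₁ w)) mᵨ)) φ ≡⟨ cong (λ w' → sat d w' φ) (world-cong d λ {ψ} _ → eval-* ψ) ⟨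
    sat d (translate ρ d w) φ                     ∎
    where
    open ≡-Reasoning
    mᵨ : Fm → Bool
    mᵨ ψ = sat d w (ρ ⟨ ψ * ρ ⟩)
    normal : ∀ d → Normal d (λ ψ → sat d w (ρ ⟨ ψ * ρ ⟩))
    normal zero    = tt
    normal (suc d) {ψ} q = sat-⟨⟩-cong d w ρ-deg same-here same-extension
      where
      nf-𝓕 = DCF-𝓕 d (extension d ψ)
      same-extension : extension d (ψ * ρ) ≡ extension d (nf d ψ * ρ)
      same-extension = map-cong (λ w' →
        trans (sat-* ρ-deg d w' q) (trans (sym (sat-nf d ψ (world-∈ d _))) (sym (sat-* ρ-deg d w' nf-𝓕))))
        (worlds d)
      same-here : sat (suc d) w (ψ * ρ) ≡ sat (suc d) w (nf d ψ * ρ)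
      same-here = trans (sat-restrict d w (*-𝓕 ρ-deg q)) (trans (map-≡-∈ same-extension (world-∈ d _))
        (sym (sat-restrict d w (*-𝓕 ρ-deg nf-𝓕))))

  translate-inverse : InversePair ρ ρ' → ∀ d {w} → w ∈ worlds d → translate ρ' d (translate ρ d w) ≡ w
  translate-inverse {ρ} {ρ'} inv d {w} w∈ = trans (world-cong d λ {φ} p → begin
      sat d (translate ρ d w) (φ * ρ') ≡⟨ sat-* degree≤1ˡ d w (*-𝓕 degree≤1ʳ p) ⟨
      sat d w ((φ * ρ') * ρ)           ≡⟨ cong (sat d w) (*-* φ) ⟩
      sat d w (φ * (ρ' * ρ))           ≡⟨ sat-*-identity identityʳ d w p ⟩
      sat d w φ                        ∎)
    (world-sat d w∈)
    where
    open ≡-Reasoning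
    open InversePair inv

  sat-minterm : ∀ d {q w} → q ∈ worlds d → w ∈ worlds d → sat d w (minterm d q) ≡ (q ==ʷ w)
  sat-minterm d {q} q∈ w∈ = trans (eval-minterm d q∈) (cong (q ==ʷ_) (world-sat d w∈))

  minterm-* : InversePair ρ ρ' → ∀ d {q} → q ∈ worlds d → minterm d q * ρ ≈ minterm d (translate ρ' d q)
  minterm-* {ρ} {ρ'} inv d {q} q∈ =
    ≈-complete (*-𝓕 degree≤1ˡ (minterm-𝓕 d q)) (minterm-𝓕 d _) λ {w} w∈ → begin
      sat d w (minterm d q * ρ)
        ≡⟨ sat-* degree≤1ˡ d w (minterm-𝓕 d q) ⟩
      sat d (translate ρ d w) (minterm d q)
        ≡⟨ sat-minterm d q∈ (world-∈ d _) ⟩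
      (q ==ʷ translate ρ d w)
        ≡⟨ Chooseʷ.≟ᵇ-transpose {f = translate ρ d} {g = translate ρ' d}
             (translate-inverse (InversePair-sym inv) d q∈) (translate-inverse inv d w∈) ⟩
      (translate ρ' d q ==ʷ w)
        ≡⟨ sat-minterm d (world-∈ d _) w∈ ⟨
      sat d w (minterm d (translate ρ' d q)) ∎
    where
    open ≡-Reasoning
    open InversePair inv

module _ {A B : Set} (enc : A → B) where

  elem : ∀ L → Fin (length (map enc L)) → A
  elem (x ∷ L) zero    = x
  elem (x ∷ L) (suc i) = elem L i

  position : ∀ {L x} → x ∈ L → Fin (length (map enc L))
  position (here _)  = zero
  position (there p) = suc (position p)

  lookup-elem : ∀ L i → lookup (map enc L) i ≡ enc (elem L i)
  lookup-elem (x ∷ L) zero    = refl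
  lookup-elem (x ∷ L) (suc i) = lookup-elem L i

  elem-∈ : ∀ L i → elem L i ∈ L
  elem-∈ (x ∷ L) zero    = here refl
  elem-∈ (x ∷ L) (suc i) = there (elem-∈ L i)

  elem-position : ∀ {L x} (p : x ∈ L) → elem L (position p) ≡ x
  elem-position (here refl) = refl
  elem-position (there p)   = elem-position p

  elem-injective : ∀ {L} → Unique L → ∀ i j → elem L i ≡ elem L j → i ≡ j
  elem-injective (_ ∷ L!)   zero    zero    _  = refl
  elem-injective (x∉L ∷ L!) zero    (suc j) eq = ⊥-elim (All.lookup x∉L (elem-∈ _ j) eq)
  elem-injective (x∉L ∷ L!) (suc i) zero    eq = ⊥-elim (All.lookup x∉L (elem-∈ _ i) (sym eq))
  elem-injective (_ ∷ L!)   (suc i) (suc j) eq = cong suc (elem-injective L! i j eq)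

record MintermPermutation (ρ ρ' : Fm) {n : ℕ} (μ : Fin n → Fm) : Set where
  field
    f g   : Fin n → Fin n
    f∘g   : ∀ i → f (g i) ≡ i
    g∘f   : ∀ i → g (f i) ≡ i
    μ-*ρ  : ∀ i → μ i * ρ ≈ μ (f i)
    μ-*ρ' : ∀ i → μ i * ρ' ≈ μ (g i)

mintermPermutation : InversePair ρ ρ' → ∀ v d → MintermPermutation ρ ρ' (μ v d)
mintermPermutation {ρ} {ρ'} inv v d =
  subst (λ Ms → MintermPermutation ρ ρ' (lookup Ms)) (sym (minterms-worlds d)) permutation
  where
  open Canonical v
  W = worlds d
  relabel : Fm → Fin (length (map (minterm d) W)) → Fin (length (map (minterm d) W))
  relabel τ i = position (minterm d) (world-∈ d (λ φ → sat d (elem (minterm d) W i) (φ * τ)))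
  elem-relabel : ∀ τ i → elem (minterm d) W (relabel τ i) ≡ translate τ d (elem (minterm d) W i)
  elem-relabel τ i = elem-position (minterm d) (world-∈ d _)
  relabel-inverse : ∀ {τ τ'} → InversePair τ τ' → ∀ i → relabel τ' (relabel τ i) ≡ i
  relabel-inverse {τ} {τ'} inv i = elem-injective (minterm d) (worlds-unique d) _ _ (begin
    elem (minterm d) W (relabel τ' (relabel τ i))     ≡⟨ elem-relabel τ' _ ⟩
    translate τ' d (elem (minterm d) W (relabel τ i)) ≡⟨ cong (translate τ' d) (elem-relabel τ i) ⟩
    translate τ' d (translate τ d w)                  ≡⟨ translate-inverse inv d (elem-∈ (minterm d) W i) ⟩
    w                                                 ∎)
    where
    open ≡-Reasoning
    w = elem (minterm d) W i
  relabel-* : ∀ {τ τ'} → InversePair τ τ' → ∀ i →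
    lookup (map (minterm d) W) i * τ ≈ lookup (map (minterm d) W) (relabel τ' i)
  relabel-* {τ} {τ'} inv i =
    subst₂ (λ X Y → X * τ ≈ Y) (sym (lookup-elem (minterm d) W i)) (sym (lookup-elem (minterm d) W _))
    (subst (λ w → minterm d (elem (minterm d) W i) * τ ≈ minterm d w) (sym (elem-relabel τ' i))
      (minterm-* inv d (elem-∈ (minterm d) W i)))
  permutation : MintermPermutation ρ ρ' (lookup (map (minterm d) W))
  permutation = record
    { f = relabel ρ' ; g = relabel ρ
    ; f∘g = relabel-inverse inv ; g∘f = relabel-inverse (InversePair-sym inv)
    ; μ-*ρ = relabel-* inv ; μ-*ρ' = relabel-* (InversePair-sym inv) }

Orb-≈ʳ : ∀ {v d i j k} → Orb v d i j → μ v d j ≈ μ v d k → Orb v d i k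
Orb-≈ʳ (ς , ς-prime , μiς≈μj) μj≈μk = ς , ς-prime , ≈-trans μiς≈μj μj≈μk

Orb-* : ∀ {v d} (f : Fin (N v d) → Fin (N v d)) → (∀ i → μ v d i * ρ ≈ μ v d (f i)) →
        ∀ {i j} → Orb v d i j → Orb v d (f i) (f j)
Orb-* {ρ} {v} {d} f μ-* {i} {j} (ς , ς-prime , μiς≈μj) = ς , ς-prime ,
  ≈-trans (us (ext ς) (≈-sym (μ-* i)))
    (subst (_≈ μ v d (f j)) (∘ˢ-* (proj₁ ς-prime) (μ v d i)) (≈-trans (⊢E-* μiς≈μj) (μ-* j)))

module _ {ρ ρ'} (v d : ℕ) (P : MintermPermutation ρ ρ' (μ v d)) where
  open MintermPermutation P

  partA : PartA ρ v d
  partA = f , μ-*ρ , Bijection.bijective (↔⇒⤖ (mk↔ₛ′ f g f∘g g∘f))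

  Orb-f : ∀ i j → Orb v d i j ⇔ Orb v d (f i) (f j)
  Orb-f i j =
    mk⇔ (Orb-* {v = v} {d} f μ-*ρ) (subst₂ (Orb v d) (g∘f i) (g∘f j) ∘ Orb-* {v = v} {d} g μ-*ρ')

  orbMul-orbit : ∀ {ω i₀} → (∀ j → ω j ⇔ Orb v d i₀ j) → ∀ j → orbMul v d ω ρ j ⇔ Orb v d (f i₀) j
  orbMul-orbit {ω} {i₀} ω⇔ j = mk⇔ to from
    where
    to : orbMul v d ω ρ j → Orb v d (f i₀) j
    to (i , ωi , μiρ≈μj) =
      Orb-≈ʳ {v} {d} (Equivalence.to (Orb-f i₀ i) (Equivalence.to (ω⇔ i) ωi))
                     (≈-trans (≈-sym (μ-*ρ i)) μiρ≈μj)
    from : Orb v d (f i₀) j → orbMul v d ω ρ j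
    from o = g j
           , Equivalence.from (ω⇔ (g j))
               (Equivalence.from (Orb-f i₀ (g j)) (subst (Orb v d (f i₀)) (sym (f∘g j)) o))
           , subst (λ k → μ v d (g j) * ρ ≈ μ v d k) (f∘g j) (μ-*ρ (g j))

  partB : PartB ρ v d
  partB = image , injective , surjective
    where
    open SetoidReasoning (⇔-setoid 0ℓ)
    image : ∀ ω → IsPrimeOrbit v d ω → IsPrimeOrbit v d (orbMul v d ω ρ)
    image ω (i , ω⇔) = f i , orbMul-orbit ω⇔
    injective : ∀ ω₁ ω₂ → IsPrimeOrbit v d ω₁ → IsPrimeOrbit v d ω₂ →
                SameSet v d (orbMul v d ω₁ ρ) (orbMul v d ω₂ ρ) → SameSet v d ω₁ ω₂
    injective ω₁ ω₂ (i₁ , ω₁⇔) (i₂ , ω₂⇔) same j = begin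
      ω₁ j                    ≈⟨ ω₁⇔ j ⟩
      Orb v d i₁ j            ≈⟨ Orb-f i₁ j ⟩
      Orb v d (f i₁) (f j)    ≈⟨ orbMul-orbit ω₁⇔ (f j) ⟨
      orbMul v d ω₁ ρ (f j)   ≈⟨ same (f j) ⟩
      orbMul v d ω₂ ρ (f j)   ≈⟨ orbMul-orbit ω₂⇔ (f j) ⟩
      Orb v d (f i₂) (f j)    ≈⟨ Orb-f i₂ j ⟨
      Orb v d i₂ j            ≈⟨ ω₂⇔ j ⟨
      ω₂ j                    ∎
    surjective : ∀ ω' → IsPrimeOrbit v d ω' →
                 Σ (MSet v d) λ ω → IsPrimeOrbit v d ω × SameSet v d (orbMul v d ω ρ) ω'
    surjective ω' (i' , ω'⇔) = Orb v d (g i') , (g i' , λ _ → ⇔-refl) , λ j → begin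
      orbMul v d (Orb v d (g i')) ρ j  ≈⟨ orbMul-orbit (λ _ → ⇔-refl) j ⟩
      Orb v d (f (g i')) j             ≡⟨ cong (λ k → Orb v d k j) (f∘g i') ⟩
      Orb v d i' j                     ≈⟨ ω'⇔ j ⟨
      ω' j                             ∎

∀ᵇ? : {P : Bool → Set} → (∀ b → Dec (P b)) → Dec (∀ b → P b)
∀ᵇ? P? = map′ (λ (t , f) → λ { true → t ; false → f }) (λ h → h true , h false) (P? true ×-dec P? false)

binary : Bool → Bool → Bool → Bool → Bool → Bool → Bool
binary t₁ t₂ t₃ t₄ true  true  = t₁
binary t₁ t₂ t₃ t₄ true  false = t₂
binary t₁ t₂ t₃ t₄ false true  = t₃
binary t₁ t₂ t₃ t₄ false false = t₄

binary-table : ∀ (M : Bool → Bool → Bool) x y →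
               M x y ≡ binary (M true true) (M true false) (M false true) (M false false) x y
binary-table M true  true  = refl
binary-table M true  false = refl
binary-table M false true  = refl
binary-table M false false = refl

actsLike◇? : Degree≤1 χ → Dec (ActsLike◇ χ)
actsLike◇? {χ} χ-deg = map′ sound (λ h x t₁ t₂ t₃ t₄ → h x (binary t₁ t₂ t₃ t₄))
  (∀ᵇ? λ x → ∀ᵇ? λ t₁ → ∀ᵇ? λ t₂ → ∀ᵇ? λ t₃ → ∀ᵇ? λ t₄ →
     eval (λ _ → x) (byTable (binary t₁ t₂ t₃ t₄)) χ ≟ t₂)
  where
  sound : (∀ x t₁ t₂ t₃ t₄ → eval (λ _ → x) (byTable (binary t₁ t₂ t₃ t₄)) χ ≡ t₂) → ActsLike◇ χ
  sound h x M =
    trans (eval-local χ-deg (λ _ → refl) λ {ψ} _ → binary-table M (truthAt true ψ) (truthAt false ψ))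
          (h x _ _ _ _)

identityUR? : ∀ χ → Dec (IdentityUR χ)
identityUR? χ with degree≤1? χ
... | yes χ-deg = map′ (χ-deg ,_) proj₂ (actsLike◇? χ-deg)
... | no ¬deg   = no (¬deg ∘ proj₁)

inversePair? : ∀ ρ ρ' → Dec (InversePair ρ ρ')
inversePair? ρ ρ' =
  map′ (λ (p , q , r , s) → inversePair p q r s) (λ (inversePair p q r s) → p , q , r , s)
    (degree≤1? ρ ×-dec degree≤1? ρ' ×-dec identityUR? (ρ * ρ') ×-dec identityUR? (ρ' * ρ))

Rp1-invertible : All (λ ρ → Any (InversePair ρ) Rp1) Rp1
Rp1-invertible = toWitness {a? = All.all? (λ ρ → Any.any? (inversePair? ρ) Rp1) Rp1} tt

theorem12 : (ρ : Fm) → ρ ∈ Rp1 → (v d : ℕ) → PartA ρ v d × PartB ρ v d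
theorem12 ρ ρ∈Rp1 v d = partA v d P , partB v d P
  where
  inverse = proj₂ (Any.satisfied (All.lookup Rp1-invertible ρ∈Rp1))
  P = mintermPermutation inverse v d
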